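{- Let $3\le m\le n$ and let $c$ be an exact $(m+n+1)$-coloring of $[m]\times[n]$ with no rainbow solution to $x_1+x_2=x_3$. Then there are at least $m+n-2\log_2(m/s_2)-2$ pairs of consecutive contributing off-diagonals, i.e. indices $k$ such that $D_k$ and $D_{k+1}$ are both contributing off-diagonals.
   Context: $[m]\times[n]=\{(i,j)\in\mathbb{Z}^2:1\le i\le m,1\le j\le n\}$ with componentwise addition. An $r$-coloring is a map $c:[m]\times[n]\to\{1,\dots,r\}$, exact if surjective; a rainbow solution is a triple $\alpha,\beta,\gamma$ with $\alpha+\beta=\gamma$ and pairwise distinct colors. For $1\le k\le m+n-1$, $D_k=\{(i,j)\in[m]\times[n]:m-k=i-j\}$; $D_m$ is the main diagonal and the $D_k$, $k\ne m$, are off-diagonals; $c(X)=\{c(x):x\in X\}$. Diagonal $D_j$ contributes color $x$ if $x\in c(D_j)\setminus c(D_m)$ and $x\notin c(D_i)$ for all $i<j$; $D_j$ is contributing if it contributes some color. $s_2=\min\{x: c((x,x))\ne c((1,1))\}$ (which exists under these hypotheses). -}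

module Defs where

open import Data.Nat using (ℕ; zero; suc; _+_; _*_; _∸_; _^_; _≤_; _<_)
open import Data.Fin using (Fin; toℕ)
open import Data.Product using (Σ; ∃; ∃-syntax; _×_; _,_)
open import Data.List using (List; length)
open import Data.List.Relation.Unary.All using (All)
open import Data.List.Relation.Unary.Unique.Propositional using (Unique)
open import Relation.Nullary using (¬_)
open import Relation.Binary.PropositionalEquality using (_≡_; _≢_)

-- A coloring of [m]×[n] with r colours. Point (i , j) : Fin m × Fin n
-- represents the grid point (toℕ i + 1 , toℕ j + 1) (1-based, as in the paper).
Coloring : ℕ → ℕ → ℕ → Set
Coloring m n r = Fin m → Fin n → Fin r

Exact : ∀ {m n r} → Coloring m n r → Set
Exact {m} {n} {r} c = ∀ (x : Fin r) → ∃[ i ] ∃[ j ] c i j ≡ x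

-- α + β = γ componentwise, in 1-based coordinates:
-- (a+1) + (b+1) = (g+1)  iff  a + b + 1 = g  (0-based toℕ values).
RainbowSolution : ∀ {m n r} → Coloring m n r → Set
RainbowSolution {m} {n} c =
  ∃[ a₁ ] ∃[ a₂ ] ∃[ b₁ ] ∃[ b₂ ] ∃[ g₁ ] ∃[ g₂ ]
    ( (suc (toℕ {m} a₁ + toℕ b₁) ≡ toℕ g₁)
    × (suc (toℕ {n} a₂ + toℕ b₂) ≡ toℕ g₂)
    × (c a₁ a₂ ≢ c b₁ b₂)
    × (c a₁ a₂ ≢ c g₁ g₂)
    × (c b₁ b₂ ≢ c g₁ g₂) )

NoRainbow : ∀ {m n r} → Coloring m n r → Set
NoRainbow c = ¬ RainbowSolution c

-- (i , j) ∈ D_k  iff  m - k = I - J  (I, J the 1-based coordinates),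
-- i.e.  I + k = m + J.
InDiag : (m n k : ℕ) → Fin m → Fin n → Set
InDiag m n k i j = suc (toℕ i) + k ≡ m + suc (toℕ j)

ColorIn : ∀ {m n r} → Coloring m n r → ℕ → Fin r → Set
ColorIn {m} {n} c k x = ∃[ i ] ∃[ j ] (InDiag m n k i j × c i j ≡ x)

Contributes : ∀ {m n r} → Coloring m n r → ℕ → Fin r → Set
Contributes {m} c k x =
  ColorIn c k x × ¬ ColorIn c m x × (∀ i → 1 ≤ i → i < k → ¬ ColorIn c i x)

Contributing : ∀ {m n r} → Coloring m n r → ℕ → Set
Contributing {r = r} c k = ∃[ x ] Contributes {r = r} c k x

ContributingOffDiag : ∀ {m n r} → Coloring m n r → ℕ → Set
ContributingOffDiag {m} {n} c k =
  1 ≤ k × k ≤ m + n ∸ 1 × k ≢ m × Contributing c k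

ConsecPair : ∀ {m n r} → Coloring m n r → ℕ → Set
ConsecPair c k = ContributingOffDiag c k × ContributingOffDiag c (suc k)

Col11 : ∀ {m n r} → Coloring m n r → Fin r → Set
Col11 c x = ∃[ i₀ ] ∃[ j₀ ] (toℕ i₀ ≡ 0 × toℕ j₀ ≡ 0 × c i₀ j₀ ≡ x)

-- s is s₂ = min { x : c((x,x)) ≠ c((1,1)) }   (s is 1-based)
IsS2 : ∀ {m n r} → Coloring m n r → ℕ → Set
IsS2 c s =
  (∃[ i ] ∃[ j ] (toℕ i ≡ toℕ j × suc (toℕ i) ≡ s × ¬ Col11 c (c i j)))
  × (∀ i j → toℕ i ≡ toℕ j → suc (toℕ i) < s → Col11 c (c i j))

-- "number of pairs ≥ m + n - 2 log₂(m/s) - 2", for 1 ≤ s ≤ m, rendered without reals: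
-- with P the number of pairs and d = (m+n-2) - P, the inequality P ≥ m+n-2-2log₂(m/s)
-- is equivalent to d ≤ 0 or 2^d ≤ (m/s)², i.e. s² · 2^(max(d,0)) ≤ m².
LogBound : (m n s P : ℕ) → Set
LogBound m n s P = s * s * 2 ^ ((m + n ∸ 2) ∸ P) ≤ m * m

ManyConsecPairs : ∀ {m n r} → Coloring m n r → ℕ → Set
ManyConsecPairs {m} {n} c s =
  ∃[ ks ] (Unique ks × All (ConsecPair c) ks × LogBound m n s (length ks))

-- For points α < γ on a common diagonal D_k the difference γ − α lies on the main diagonal, so
-- two distinct colors outside c(D_m) never share a diagonal: α + (γ − α) = γ would be rainbow.
-- Since each color outside c(D_m) is contributed by the first diagonal containing it, the
-- m + n + 1 colors number at most |c(D_m)| + C, where C counts contributing off-diagonals.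
-- Along the main diagonal, a color appearing for the first time at (1-based) position u after one
-- first appearing at f forces u ≥ 2f: otherwise (u − f) + f = u is rainbow. The color first changes
-- at s₂, so |c(D_m)| ≤ 2 + e with s₂·2^e ≤ m. Finally, C contributing diagonals among the
-- m + n − 1 form at least 2C − (m + n) adjacent pairs, and the three estimates combine to
-- m + n − 2 − #pairs ≤ 2e ≤ 2 log₂(m/s₂).
module Submission where

open import Defs
open import Data.Nat
  using (ℕ; zero; suc; _+_; _*_; _∸_; _^_; _≤_; _<_; _≤′_; ≤′-refl; ≤′-step; z≤n; s≤s; s≤s⁻¹; _≤?_; _<?_)
open import Data.Nat.Properties
open import Data.Nat.Induction using (<-rec)
open import Data.Nat.Tactic.RingSolver using (solve-∀)
open import Data.Fin using (Fin; zero; suc; toℕ; fromℕ<; inject≤)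
open import Data.Fin.Properties
  using (any?; toℕ-fromℕ<; toℕ-injective; toℕ<n; toℕ-inject≤) renaming (_≟_ to _≟ᶠ_)
import Data.Fin.Properties as Finₚ
open import Data.Product using (∃; _×_; _,_; proj₁; proj₂)
open import Data.Sum using (_⊎_; inj₁; inj₂)
open import Data.Unit using (⊤; tt)
open import Data.Empty using (⊥; ⊥-elim)
open import Data.List using (List; []; _∷_; map; length)
open import Data.List.Properties using (length-map)
open import Data.List.Relation.Unary.All using (All; []; _∷_; universal)
import Data.List.Relation.Unary.All.Properties as All
open import Data.List.Relation.Unary.AllPairs using (_∷_)
open import Data.List.Relation.Unary.Unique.Propositional using (Unique; [])
import Data.List.Relation.Unary.Unique.Propositional.Properties as Unique
open import Algebra.Properties.CommutativeMonoid.Sum +-0-commutativeMonoid using (sum; ∑-comm; ∑-distrib-+)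
open import Algebra.Properties.CommutativeSemigroup *-commutativeSemigroup using (x∙yz≈y∙xz)
open import Relation.Binary.Definitions using (tri<; tri≈; tri>)
open import Relation.Nullary using (¬_; Dec; yes; no; contradiction)
open import Relation.Nullary.Decidable using (_×-dec_; _→-dec_; ¬?; map′; toSum; decidable-stable)
open import Relation.Unary using (Decidable)
open import Relation.Binary.PropositionalEquality
  using (_≡_; _≢_; refl; sym; trans; cong; cong₂; subst; module ≡-Reasoning)

𝟙 : ∀ {A : Set} → Dec A → ℕ
𝟙 (yes _) = 1
𝟙 (no _)  = 0

𝟙≤1 : ∀ {A : Set} (a? : Dec A) → 𝟙 a? ≤ 1
𝟙≤1 (yes _) = s≤s z≤n
𝟙≤1 (no _)  = z≤n

𝟙-mono : ∀ {A B : Set} (a? : Dec A) (b? : Dec B) → (A → B) → 𝟙 a? ≤ 𝟙 b?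
𝟙-mono (yes _) (yes _) _ = ≤-refl
𝟙-mono (yes a) (no ¬b) f = contradiction (f a) ¬b
𝟙-mono (no _)  _       _ = z≤n

𝟙-⊎ : ∀ {A B C : Set} (a? : Dec A) (b? : Dec B) (c? : Dec C) → (A → B ⊎ C) → 𝟙 a? ≤ 𝟙 b? + 𝟙 c?
𝟙-⊎ (no _)  _        _       _ = z≤n
𝟙-⊎ (yes _) (yes _)  _       _ = s≤s z≤n
𝟙-⊎ (yes _) (no _)   (yes _) _ = ≤-refl
𝟙-⊎ (yes a) (no ¬b)  (no ¬c) f with f a
... | inj₁ b = contradiction b ¬b
... | inj₂ c = contradiction c ¬c

𝟙≤ : ∀ {A : Set} (a? : Dec A) {n} → (A → 1 ≤ n) → 𝟙 a? ≤ n
𝟙≤ (yes a) h = h a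
𝟙≤ (no _)  _ = z≤n

𝟙-no : ∀ {A : Set} (a? : Dec A) → ¬ A → 𝟙 a? ≡ 0
𝟙-no (yes a) ¬a = contradiction a ¬a
𝟙-no (no _)  _  = refl

sum-mono : ∀ {k} {f g : Fin k → ℕ} → (∀ i → f i ≤ g i) → sum f ≤ sum g
sum-mono {k = zero}  _   = z≤n
sum-mono {k = suc k} f≤g = +-mono-≤ (f≤g zero) (sum-mono (λ i → f≤g (suc i)))

count : ∀ {k} {P : Fin k → Set} → Decidable P → ℕ
count P? = sum (λ x → 𝟙 (P? x))

count-≥1 : ∀ {k} {P : Fin k → Set} (P? : Decidable P) → ∀ {x} → P x → 1 ≤ count P?
count-≥1 P? {zero} px with P? zero
... | yes _  = s≤s z≤n
... | no ¬px = contradiction px ¬px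
count-≥1 P? {suc x} px = ≤-trans (count-≥1 (λ i → P? (suc i)) px) (m≤n+m _ (𝟙 (P? zero)))

count-none : ∀ {k} {P : Fin k → Set} (P? : Decidable P) → (∀ x → ¬ P x) → count P? ≡ 0
count-none {k = zero}  _  _  = refl
count-none {k = suc k} P? ¬p with P? zero
... | yes p0 = contradiction p0 (¬p zero)
... | no _   = count-none (λ i → P? (suc i)) (λ i → ¬p (suc i))

count-all : ∀ {k} {P : Fin k → Set} (P? : Decidable P) → (∀ x → P x) → count P? ≡ k
count-all {k = zero}  _  _ = refl
count-all {k = suc k} P? p with P? zero
... | yes _   = cong suc (count-all (λ i → P? (suc i)) (λ i → p (suc i)))
... | no ¬p0  = contradiction (p zero) ¬p0

count-mono : ∀ {k} {P Q : Fin k → Set} (P? : Decidable P) (Q? : Decidable Q) →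
  (∀ {x} → P x → Q x) → count P? ≤ count Q?
count-mono P? Q? P⊆Q = sum-mono (λ x → 𝟙-mono (P? x) (Q? x) P⊆Q)

count-⊆∪ : ∀ {k} {P Q R : Fin k → Set} (P? : Decidable P) (Q? : Decidable Q) (R? : Decidable R) →
  (∀ {x} → P x → Q x ⊎ R x) → count P? ≤ count Q? + count R?
count-⊆∪ P? Q? R? P⊆Q∪R = begin
  count P?                                      ≤⟨ sum-mono (λ x → 𝟙-⊎ (P? x) (Q? x) (R? x) P⊆Q∪R) ⟩
  sum (λ x → 𝟙 (Q? x) + 𝟙 (R? x))               ≡⟨ ∑-distrib-+ (λ x → 𝟙 (Q? x)) (λ x → 𝟙 (R? x)) ⟩
  count Q? + count R?                           ∎
  where open ≤-Reasoning

count-≤1 : ∀ {k} {P : Fin k → Set} (P? : Decidable P) →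
  (∀ {x y} → P x → P y → x ≡ y) → count P? ≤ 1
count-≤1 {k = zero}  _  _      = z≤n
count-≤1 {k = suc k} P? unique with P? zero
... | yes p0 = s≤s (≤-reflexive (count-none (λ i → P? (suc i)) (λ i pi → Finₚ.0≢1+n (unique p0 pi))))
... | no _   = count-≤1 (λ i → P? (suc i)) (λ px py → Finₚ.suc-injective (unique px py))

count-singleton : ∀ {r} (y : Fin r) → count (_≟ᶠ y) ≤ 1
count-singleton y = count-≤1 (_≟ᶠ y) (λ x≡y x′≡y → trans x≡y (sym x′≡y))

count-≤-byUniquePartner : ∀ {k l} {P : Fin k → Set} {Q : Fin l → Set} {R : Fin k → Fin l → Set}
  (P? : Decidable P) (Q? : Decidable Q) (R? : ∀ x y → Dec (R x y)) →
  (∀ {x} → P x → ∃ λ y → R x y × Q y) →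
  (∀ {x x′ y} → R x y → R x′ y → x ≡ x′) →
  count P? ≤ count Q?
count-≤-byUniquePartner {P = P} P? Q? R? partner unique = begin
  count P?                                         ≤⟨ sum-mono (λ x → 𝟙≤ (P? x) (has-partner x)) ⟩
  sum (λ x → sum (λ y → 𝟙 (R? x y ×-dec Q? y)))   ≡⟨ ∑-comm (λ x y → 𝟙 (R? x y ×-dec Q? y)) ⟩
  sum (λ y → sum (λ x → 𝟙 (R? x y ×-dec Q? y)))   ≤⟨ sum-mono at-most-one-partner ⟩
  count Q?                                         ∎
  where
  open ≤-Reasoning
  has-partner : ∀ x → P x → 1 ≤ count (λ y → R? x y ×-dec Q? y)
  has-partner x px with y , rxy , qy ← partner px = count-≥1 (λ y → R? x y ×-dec Q? y) (rxy , qy)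
  at-most-one-partner : ∀ y → count (λ x → R? x y ×-dec Q? y) ≤ 𝟙 (Q? y)
  at-most-one-partner y with Q? y
  ... | yes _  = count-≤1 (λ x → R? x y ×-dec yes _) (λ (rxy , _) (rx′y , _) → unique rxy rx′y)
  ... | no ¬qy = ≤-reflexive (count-none (λ x → R? x y ×-dec no ¬qy) (λ x (_ , qy) → ¬qy qy))

count-excludedMiddle : ∀ {k} {P : Fin k → Set} (P? : Decidable P) →
  k ≤ count P? + count (λ x → ¬? (P? x))
count-excludedMiddle {k} P? = begin
  k                                   ≡⟨ sym (count-all always (λ _ → tt)) ⟩
  count always                        ≤⟨ count-⊆∪ always P? (λ x → ¬? (P? x)) (λ {x} _ → toSum (P? x)) ⟩
  count P? + count (λ x → ¬? (P? x))  ∎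
  where
  open ≤-Reasoning
  always : Decidable {A = Fin k} (λ _ → ⊤)
  always _ = yes tt

consIfBoth : ∀ {A B : Set} → Dec A → Dec B → ℕ → List ℕ → List ℕ
consIfBoth (yes _) (yes _) x xs = x ∷ xs
consIfBoth _       _       _ xs = xs

adjacentPairs : ∀ {P : ℕ → Set} → Decidable P → ℕ → List ℕ
adjacentPairs P? zero    = []
adjacentPairs P? (suc ℓ) = consIfBoth (P? 0) (P? 1) 0 (map suc (adjacentPairs (λ i → P? (suc i)) ℓ))

All-consIfBoth : ∀ {A B : Set} {Q : ℕ → Set} (a? : Dec A) (b? : Dec B) {x xs} →
  (A → B → Q x) → All Q xs → All Q (consIfBoth a? b? x xs)
All-consIfBoth (yes a) (yes b) qx qxs = qx a b ∷ qxs
All-consIfBoth (yes _) (no _)  _  qxs = qxs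
All-consIfBoth (no _)  _       _  qxs = qxs

Unique-consIfBoth : ∀ {A B : Set} (a? : Dec A) (b? : Dec B) {x xs} →
  All (x ≢_) xs → Unique xs → Unique (consIfBoth a? b? x xs)
Unique-consIfBoth (yes _) (yes _) x∉xs u = x∉xs ∷ u
Unique-consIfBoth (yes _) (no _)  _    u = u
Unique-consIfBoth (no _)  _       _    u = u

adjacentPairs-adjacent : ∀ {P : ℕ → Set} (P? : Decidable P) ℓ →
  All (λ i → P i × P (suc i)) (adjacentPairs P? ℓ)
adjacentPairs-adjacent P? zero    = []
adjacentPairs-adjacent P? (suc ℓ) =
  All-consIfBoth (P? 0) (P? 1) _,_ (All.map⁺ (adjacentPairs-adjacent (λ i → P? (suc i)) ℓ))

adjacentPairs-unique : ∀ {P : ℕ → Set} (P? : Decidable P) ℓ → Unique (adjacentPairs P? ℓ)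
adjacentPairs-unique P? zero    = []
adjacentPairs-unique P? (suc ℓ) =
  Unique-consIfBoth (P? 0) (P? 1) (All.map⁺ (universal (λ _ ()) rest))
    (Unique.map⁺ suc-injective (adjacentPairs-unique (λ i → P? (suc i)) ℓ))
  where
  rest : List ℕ
  rest = adjacentPairs (λ i → P? (suc i)) ℓ

adjacentPairs-step : ∀ {A B : Set} (a? : Dec A) (b? : Dec B) xs {C ℓ} →
  C + C ≤ length xs + suc ℓ + 𝟙 b? →
  (𝟙 a? + C) + (𝟙 a? + C) ≤ length (consIfBoth a? b? 0 xs) + suc (suc ℓ) + 𝟙 a?
adjacentPairs-step (yes _) (yes _) xs {C} {ℓ} h = begin
  (1 + C) + (1 + C)           ≡⟨ cong suc (+-suc C C) ⟩
  2 + (C + C)                 ≤⟨ +-monoʳ-≤ 2 h ⟩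
  2 + (length xs + suc ℓ + 1) ≡⟨ rhs (length xs) ℓ ⟩
  suc (length xs) + suc (suc ℓ) + 1 ∎
  where
  open ≤-Reasoning
  rhs : ∀ L ℓ → 2 + (L + suc ℓ + 1) ≡ suc L + suc (suc ℓ) + 1
  rhs = solve-∀
adjacentPairs-step (yes _) (no _)  xs {C} {ℓ} h = begin
  (1 + C) + (1 + C)           ≡⟨ cong suc (+-suc C C) ⟩
  2 + (C + C)                 ≤⟨ +-monoʳ-≤ 2 h ⟩
  2 + (length xs + suc ℓ + 0) ≡⟨ rhs (length xs) ℓ ⟩
  length xs + suc (suc ℓ) + 1 ∎
  where
  open ≤-Reasoning
  rhs : ∀ L ℓ → 2 + (L + suc ℓ + 0) ≡ L + suc (suc ℓ) + 1
  rhs = solve-∀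
adjacentPairs-step (no _)  b?      xs {C} {ℓ} h = begin
  C + C                       ≤⟨ h ⟩
  length xs + suc ℓ + 𝟙 b?    ≤⟨ +-monoʳ-≤ (length xs + suc ℓ) (𝟙≤1 b?) ⟩
  length xs + suc ℓ + 1       ≡⟨ rhs (length xs) ℓ ⟩
  length xs + suc (suc ℓ) + 0 ∎
  where
  open ≤-Reasoning
  rhs : ∀ L ℓ → L + suc ℓ + 1 ≡ L + suc (suc ℓ) + 0
  rhs = solve-∀

adjacentPairs-count : ∀ {P : ℕ → Set} (P? : Decidable P) ℓ →
  let C = count {suc ℓ} (λ i → P? (toℕ i)) in
  C + C ≤ length (adjacentPairs P? ℓ) + suc ℓ + 𝟙 (P? 0)
adjacentPairs-count P? zero with P? 0
... | yes _ = ≤-refl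
... | no _  = z≤n
adjacentPairs-count P? (suc ℓ) =
  adjacentPairs-step (P? 0) (P? 1) (map suc rest)
    (subst (λ L → C + C ≤ L + suc ℓ + 𝟙 (P? 1)) (sym (length-map suc rest))
      (adjacentPairs-count (λ i → P? (suc i)) ℓ))
  where
  rest : List ℕ
  rest = adjacentPairs (λ i → P? (suc i)) ℓ
  C : ℕ
  C = count {suc ℓ} (λ i → P? (suc (toℕ i)))

adjacentPairs-count′ : ∀ {P : ℕ → Set} (P? : Decidable P) ℓ → ¬ P 0 →
  let C = count {suc ℓ} (λ i → P? (toℕ i)) in
  C + C ≤ length (adjacentPairs P? ℓ) + suc ℓ
adjacentPairs-count′ P? ℓ ¬p0 = ≤-trans (adjacentPairs-count P? ℓ) (≤-reflexive (begin
  L + suc ℓ + 𝟙 (P? 0)  ≡⟨ cong (L + suc ℓ +_) (𝟙-no (P? 0) ¬p0) ⟩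
  L + suc ℓ + 0         ≡⟨ +-identityʳ (L + suc ℓ) ⟩
  L + suc ℓ             ∎))
  where
  open ≡-Reasoning
  L : ℕ
  L = length (adjacentPairs P? ℓ)

RainbowFree : ∀ {m r} → (Fin m → Fin r) → Set
RainbowFree d = ∀ a b g → suc (toℕ a + toℕ b) ≡ toℕ g → d a ≢ d b → d a ≢ d g → d b ≢ d g → ⊥

module _ {m r} (d : Fin m → Fin r) where

  Seen : ℕ → Fin r → Set
  Seen t x = ∃ λ i → toℕ i < t × d i ≡ x

  seen? : ∀ t → Decidable (Seen t)
  seen? t x = any? (λ i → (toℕ i <? t) ×-dec (d i ≟ᶠ x))

  New : Fin m → Set
  New u = ¬ Seen (toℕ u) (d u)

  Seen-suc : ∀ {t x} (u : Fin m) → toℕ u ≡ t → Seen (suc t) x → Seen t x ⊎ x ≡ d u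
  Seen-suc u refl (i , i<1+u , dᵢ≡x) with m≤n⇒m<n∨m≡n (s≤s⁻¹ i<1+u)
  ... | inj₁ i<u = inj₁ (i , i<u , dᵢ≡x)
  ... | inj₂ i≡u rewrite toℕ-injective i≡u = inj₂ (sym dᵢ≡x)

  count-seen-repeat : ∀ {t} (u : Fin m) → toℕ u ≡ t → Seen t (d u) →
    count (seen? (suc t)) ≤ count (seen? t)
  count-seen-repeat {t} u u≡t seen = count-mono (seen? (suc t)) (seen? t) old
    where
    old : ∀ {x} → Seen (suc t) x → Seen t x
    old s with Seen-suc u u≡t s
    ... | inj₁ s′  = s′
    ... | inj₂ refl = seen

  count-seen-suc : ∀ {t} (u : Fin m) → toℕ u ≡ t → count (seen? (suc t)) ≤ count (seen? t) + 1
  count-seen-suc {t} u u≡t = begin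
    count (seen? (suc t))              ≤⟨ count-⊆∪ (seen? (suc t)) (seen? t) (_≟ᶠ d u) (Seen-suc u u≡t) ⟩
    count (seen? t) + count (_≟ᶠ d u)  ≤⟨ +-monoʳ-≤ (count (seen? t)) (count-singleton (d u)) ⟩
    count (seen? t) + 1                ∎
    where open ≤-Reasoning

  new-doubles : RainbowFree d → ∀ {f u} → New f → New u → toℕ f < toℕ u →
    2 * suc (toℕ f) ≤ suc (toℕ u)
  new-doubles rainbowFree {f} {u} new-f new-u f<u with 2 * suc (toℕ f) ≤? suc (toℕ u)
  ... | yes doubled = doubled
  ... | no ¬doubled = ⊥-elim (rainbowFree a f u a+f≡u
                        (λ dₐ≡df → new-f (a , a<f , dₐ≡df))
                        (λ dₐ≡du → new-u (a , <-trans a<f f<u , dₐ≡du))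
                        (λ df≡du → new-u (f , f<u , df≡du)))
    where
    F : ℕ
    F = toℕ f
    j : ℕ
    j = toℕ u ∸ suc F
    j+1+F≡u : j + suc F ≡ toℕ u
    j+1+F≡u = m∸n+n≡m f<u
    j<F : j < F
    j<F = +-cancelʳ-≤ (suc F) (suc j) F (begin
      suc j + suc F       ≡⟨ cong suc j+1+F≡u ⟩
      suc (toℕ u)         ≤⟨ s≤s⁻¹ (≰⇒> ¬doubled) ⟩
      F + (suc F + 0)     ≡⟨ cong (F +_) (+-identityʳ (suc F)) ⟩
      F + suc F           ∎)
      where open ≤-Reasoning
    a : Fin m
    a = fromℕ< (<-trans j<F (toℕ<n f))
    a<f : toℕ a < F
    a<f = subst (_< F) (sym (toℕ-fromℕ< _)) j<F
    a+f≡u : suc (toℕ a + F) ≡ toℕ u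
    a+f≡u = trans (cong (λ i → suc (i + F)) (toℕ-fromℕ< _)) (trans (sym (+-suc j F)) j+1+F≡u)

  module _ (rainbowFree : RainbowFree d) (p : Fin m) (x₀ : Fin r)
           (before-p : ∀ i → toℕ i < toℕ p → d i ≡ x₀) (changes-at-p : d p ≢ x₀) where

    -- e counts the colors that appeared after the first two; f is a position where a color
    -- appeared for the first time, at least 2^e times as far out as p (1-based).
    PaletteGrowth : ℕ → Set
    PaletteGrowth t = ∃ λ e → count (seen? t) ≤ 2 + e ×
      ∃ λ f → toℕ f < t × New f × suc (toℕ p) * 2 ^ e ≤ suc (toℕ f)

    growth-start : PaletteGrowth (suc (toℕ p))
    growth-start = 0 , two-colors , p , ≤-refl , new-p , ≤-reflexive (*-identityʳ _)
      where
      x₀-or-dp : ∀ {x} → Seen (suc (toℕ p)) x → x ≡ x₀ ⊎ x ≡ d p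
      x₀-or-dp s with Seen-suc p refl s
      ... | inj₁ (i , i<p , dᵢ≡x) = inj₁ (trans (sym dᵢ≡x) (before-p i i<p))
      ... | inj₂ x≡dp             = inj₂ x≡dp
      two-colors : count (seen? (suc (toℕ p))) ≤ 2
      two-colors = ≤-trans (count-⊆∪ (seen? _) (_≟ᶠ x₀) (_≟ᶠ d p) x₀-or-dp)
        (+-mono-≤ (count-singleton x₀) (count-singleton (d p)))
      new-p : New p
      new-p (i , i<p , dᵢ≡dp) = changes-at-p (trans (sym dᵢ≡dp) (before-p i i<p))

    growth-step : ∀ {t} (u : Fin m) → toℕ u ≡ t → PaletteGrowth t → PaletteGrowth (suc t)
    growth-step {t} u u≡t (e , few , f , f<t , new-f , bound) with seen? t (d u)
    ... | yes seen  = e , ≤-trans (count-seen-repeat u u≡t seen) few , f , m≤n⇒m≤1+n f<t , new-f , bound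
    ... | no unseen = suc e , one-more , u , s≤s (≤-reflexive u≡t) , new-u , doubled
      where
      one-more : count (seen? (suc t)) ≤ 2 + suc e
      one-more = ≤-trans (count-seen-suc u u≡t)
        (≤-trans (+-monoˡ-≤ 1 few) (≤-reflexive (cong (2 +_) (+-comm e 1))))
      new-u : New u
      new-u = subst (λ t → ¬ Seen t (d u)) (sym u≡t) unseen
      doubled : suc (toℕ p) * 2 ^ suc e ≤ suc (toℕ u)
      doubled = begin
        suc (toℕ p) * (2 * 2 ^ e)  ≡⟨ x∙yz≈y∙xz (suc (toℕ p)) 2 (2 ^ e) ⟩
        2 * (suc (toℕ p) * 2 ^ e)  ≤⟨ *-monoʳ-≤ 2 bound ⟩
        2 * suc (toℕ f)            ≤⟨ new-doubles rainbowFree new-f new-u (subst (toℕ f <_) (sym u≡t) f<t) ⟩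
        suc (toℕ u)                ∎
        where open ≤-Reasoning

    growth : ∀ {t} → suc (toℕ p) ≤′ t → t ≤ m → PaletteGrowth t
    growth ≤′-refl                 _     = growth-start
    growth (≤′-step {t} p<t) 1+t≤m =
      growth-step (fromℕ< 1+t≤m) (toℕ-fromℕ< 1+t≤m) (growth p<t (<⇒≤ 1+t≤m))

    palette-bound : ∃ λ e → count (seen? m) ≤ 2 + e × suc (toℕ p) * 2 ^ e ≤ m
    palette-bound with e , few , f , f<m , _ , bound ← growth (≤⇒≤′ (toℕ<n p)) ≤-refl =
      e , few , ≤-trans bound f<m

Minimal : (ℕ → Set) → ℕ → Set
Minimal P j = P j × (∀ {i} → i < j → ¬ P i)

least : ∀ {P : ℕ → Set} → Decidable P → ∀ {k} → P k → ∃ (Minimal P)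
least {P} P? {k} = <-rec (λ k → P k → ∃ (Minimal P)) below k
  where
  below : ∀ k → (∀ {j} → j < k → P j → ∃ (Minimal P)) → P k → ∃ (Minimal P)
  below k smaller pk with anyUpTo? P? k
  ... | yes (j , j<k , pj) = smaller j<k pj
  ... | no none            = k , pk , λ i<k pi → none (_ , i<k , pi)

module Diagonals {m n r} (m≤n : m ≤ n) (c : Coloring m n r) (noRainbow : NoRainbow c) where

  inDiag? : ∀ k i j → Dec (InDiag m n k i j)
  inDiag? k i j = suc (toℕ i) + k ≟ m + suc (toℕ j)

  colorIn? : ∀ k → Decidable (ColorIn c k)
  colorIn? k x = any? (λ i → any? (λ j → inDiag? k i j ×-dec (c i j ≟ᶠ x)))

  contributes? : ∀ k → Decidable (Contributes c k)
  contributes? k x =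
    colorIn? k x ×-dec ¬? (colorIn? m x) ×-dec map′ uncurried curried (allUpTo? earlier? k)
    where
    earlier? : Decidable (λ i → 1 ≤ i → ¬ ColorIn c i x)
    earlier? i = (1 ≤? i) →-dec ¬? (colorIn? i x)
    uncurried : (∀ {i} → i < k → 1 ≤ i → ¬ ColorIn c i x) → ∀ i → 1 ≤ i → i < k → ¬ ColorIn c i x
    uncurried h i 1≤i i<k = h i<k 1≤i
    curried : (∀ i → 1 ≤ i → i < k → ¬ ColorIn c i x) → ∀ {i} → i < k → 1 ≤ i → ¬ ColorIn c i x
    curried h i<k 1≤i = h _ 1≤i i<k

  contributingOffDiag? : Decidable (ContributingOffDiag c)
  contributingOffDiag? k =
    (1 ≤? k) ×-dec (k ≤? m + n ∸ 1) ×-dec ¬? (k ≟ m) ×-dec any? (contributes? k)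

  diagonal-bounds : ∀ {k x} → ColorIn c k x → 1 ≤ k × k ≤ m + n ∸ 1
  diagonal-bounds {k} (i , j , onDₖ , _) = ≤-trans (s≤s z≤n) 1+j≤k , ∸-monoˡ-≤ 1 1+k≤m+n
    where
    1+j≤k : suc (toℕ j) ≤ k
    1+j≤k = +-cancelˡ-≤ m (suc (toℕ j)) k (≤-trans (≤-reflexive (sym onDₖ)) (+-monoˡ-≤ k (toℕ<n i)))
    1+k≤m+n : suc k ≤ m + n
    1+k≤m+n = ≤-trans (s≤s (m≤n+m k (toℕ i))) (≤-trans (≤-reflexive onDₖ) (+-monoʳ-≤ m (toℕ<n j)))

  contributes⇒offDiag : ∀ {k x} → Contributes c k x → ContributingOffDiag c k
  contributes⇒offDiag contrib@(inDₖ , ∉Dₘ , _) with 1≤k , k≤m+n-1 ← diagonal-bounds inDₖ =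
    1≤k , k≤m+n-1 , (λ { refl → ∉Dₘ inDₖ }) , (_ , contrib)

  diagonal-determined : ∀ {k i j j′} → InDiag m n k i j → InDiag m n k i j′ → j ≡ j′
  diagonal-determined onDₖ onDₖ′ =
    toℕ-injective (suc-injective (+-cancelˡ-≡ m _ _ (trans (sym onDₖ) onDₖ′)))

  mainColor : Fin m → Fin r
  mainColor i = c i (inject≤ i m≤n)

  onMainDiagonal : ∀ i → InDiag m n m i (inject≤ i m≤n)
  onMainDiagonal i = trans (+-comm (suc (toℕ i)) m) (cong (λ j → m + suc j) (sym (toℕ-inject≤ i m≤n)))

  main-colors : ∀ {x} → ColorIn c m x → Seen mainColor m x
  main-colors (i , j , onDₘ , cᵢⱼ≡x) =
    i , toℕ<n i , trans (cong (c i) (diagonal-determined {i = i} (onMainDiagonal i) onDₘ)) cᵢⱼ≡x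

  mainColor-rainbowFree : RainbowFree mainColor
  mainColor-rainbowFree a b g 1+a+b≡g da≢db da≢dg db≢dg = noRainbow
    (a , inject≤ a m≤n , b , inject≤ b m≤n , g , inject≤ g m≤n , 1+a+b≡g , 1+a+b≡g′ , da≢db , da≢dg , db≢dg)
    where
    1+a+b≡g′ : suc (toℕ (inject≤ a m≤n) + toℕ (inject≤ b m≤n)) ≡ toℕ (inject≤ g m≤n)
    1+a+b≡g′ rewrite toℕ-inject≤ a m≤n | toℕ-inject≤ b m≤n | toℕ-inject≤ g m≤n = 1+a+b≡g

  diagonal-gap : ∀ {k i j i′ j′} → InDiag m n k i j → InDiag m n k i′ j′ → toℕ i < toℕ i′ →
    ∃ λ t → suc (toℕ i + toℕ t) ≡ toℕ i′ × suc (toℕ j + toℕ (inject≤ t m≤n)) ≡ toℕ j′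
  diagonal-gap {k} {i} {j} {i′} {j′} onDₖ onDₖ′ i<i′ with o , 1+i+o≡i′ ← m≤n⇒∃[o]m+o≡n i<i′ =
    t , 1+i+t≡i′ , 1+j+t≡j′
    where
    o<m : o < m
    o<m = ≤-trans (s≤s (m≤n+m o (toℕ i))) (≤-trans (≤-reflexive 1+i+o≡i′) (<⇒≤ (toℕ<n i′)))
    t : Fin m
    t = fromℕ< o<m
    1+i+t≡i′ : suc (toℕ i + toℕ t) ≡ toℕ i′
    1+i+t≡i′ rewrite toℕ-fromℕ< o<m = 1+i+o≡i′
    1+j+o≡j′ : suc (toℕ j + o) ≡ toℕ j′
    1+j+o≡j′ = suc-injective (+-cancelˡ-≡ m _ _ (begin
      m + suc (suc (toℕ j + o))      ≡⟨ shift m (toℕ j) o ⟩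
      (m + suc (toℕ j)) + suc o      ≡⟨ cong (_+ suc o) (sym onDₖ) ⟩
      (suc (toℕ i) + k) + suc o      ≡⟨ swap (toℕ i) k o ⟩
      suc (suc (toℕ i) + o) + k      ≡⟨ cong (λ i → suc i + k) 1+i+o≡i′ ⟩
      suc (toℕ i′) + k               ≡⟨ onDₖ′ ⟩
      m + suc (toℕ j′)               ∎))
      where
      open ≡-Reasoning
      shift : ∀ m j o → m + suc (suc (j + o)) ≡ (m + suc j) + suc o
      shift = solve-∀
      swap : ∀ i k o → (suc i + k) + suc o ≡ suc (suc i + o) + k
      swap = solve-∀
    1+j+t≡j′ : suc (toℕ j + toℕ (inject≤ t m≤n)) ≡ toℕ j′
    1+j+t≡j′ rewrite toℕ-inject≤ t m≤n | toℕ-fromℕ< o<m = 1+j+o≡j′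

  offMain-colors-agree : ∀ {k x y i j i′ j′} → InDiag m n k i j → c i j ≡ x → ¬ ColorIn c m x →
    InDiag m n k i′ j′ → c i′ j′ ≡ y → ¬ ColorIn c m y → toℕ i < toℕ i′ → x ≡ y
  offMain-colors-agree {i = i} {j} {i′} {j′} onDₖ refl x∉Dₘ onDₖ′ refl y∉Dₘ i<i′
    with t , 1+i+t≡i′ , 1+j+t≡j′ ← diagonal-gap onDₖ onDₖ′ i<i′ =
    decidable-stable (c i j ≟ᶠ c i′ j′) λ x≢y → noRainbow
      (i , j , t , inject≤ t m≤n , i′ , j′ , 1+i+t≡i′ , 1+j+t≡j′ ,
       (λ x≡dt → x∉Dₘ (t , _ , onMainDiagonal t , sym x≡dt)) , x≢y ,
       (λ dt≡y → y∉Dₘ (t , _ , onMainDiagonal t , dt≡y)))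

  contributed-unique : ∀ {k x y} → Contributes c k x → Contributes c k y → x ≡ y
  contributed-unique ((i , j , onDₖ , cᵢⱼ≡x) , x∉Dₘ , _) ((i′ , j′ , onDₖ′ , cᵢ′ⱼ′≡y) , y∉Dₘ , _)
    with <-cmp (toℕ i) (toℕ i′)
  ... | tri< i<i′ _ _ = offMain-colors-agree onDₖ cᵢⱼ≡x x∉Dₘ onDₖ′ cᵢ′ⱼ′≡y y∉Dₘ i<i′
  ... | tri> _ _ i′<i = sym (offMain-colors-agree onDₖ′ cᵢ′ⱼ′≡y y∉Dₘ onDₖ cᵢⱼ≡x x∉Dₘ i′<i)
  ... | tri≈ _ i≡i′ _ with refl ← toℕ-injective i≡i′
    with refl ← diagonal-determined {i = i} onDₖ onDₖ′ = trans (sym cᵢⱼ≡x) cᵢ′ⱼ′≡y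

  on-its-diagonal : ∀ i j → InDiag m n (m + suc (toℕ j) ∸ suc (toℕ i)) i j
  on-its-diagonal i j = m+[n∸m]≡n (≤-trans (toℕ<n i) (m≤m+n m _))

  first-contributor : Exact c → ∀ {x} → ¬ ColorIn c m x → ∃ λ k → Contributes c k x
  first-contributor exact {x} x∉Dₘ with i , j , cᵢⱼ≡x ← exact x
    with k , inDₖ , noneBefore ← least (λ k → colorIn? k x) (i , j , on-its-diagonal i j , cᵢⱼ≡x) =
    k , inDₖ , x∉Dₘ , λ i _ i<k → noneBefore i<k

  color-count : Exact c →
    r ≤ count (colorIn? m) + count {suc (m + n ∸ 1)} (λ k → contributingOffDiag? (toℕ k))
  color-count exact = ≤-trans (count-excludedMiddle (colorIn? m))
    (+-monoʳ-≤ (count (colorIn? m))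
      (count-≤-byUniquePartner (λ x → ¬? (colorIn? m x)) (λ k → contributingOffDiag? (toℕ k))
        (λ x k → contributes? (toℕ k) x) partner contributed-unique))
    where
    partner : ∀ {x} → ¬ ColorIn c m x →
      ∃ λ (k : Fin (suc (m + n ∸ 1))) → Contributes c (toℕ k) x × ContributingOffDiag c (toℕ k)
    partner {x} x∉Dₘ with k , contrib ← first-contributor exact x∉Dₘ =
      let k<1+L = s≤s (proj₂ (diagonal-bounds (proj₁ contrib))) in
      fromℕ< k<1+L ,
      subst (λ k → Contributes c k x × ContributingOffDiag c k) (sym (toℕ-fromℕ< k<1+L))
        (contrib , contributes⇒offDiag contrib)

  isS2⇒firstChange : ∀ {s} → IsS2 c s →
    ∃ λ p → suc (toℕ p) ≡ s × ∃ λ x₀ → (∀ i → toℕ i < toℕ p → mainColor i ≡ x₀) × mainColor p ≢ x₀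
  isS2⇒firstChange ((p , j , p≡j , 1+p≡s , p∉corner) , small) = p , 1+p≡s , x₀ , before , changes
    where
    0<m : 0 < m
    0<m = ≤-trans (s≤s z≤n) (toℕ<n p)
    0<n : 0 < n
    0<n = ≤-trans 0<m m≤n
    x₀ : Fin r
    x₀ = c (fromℕ< 0<m) (fromℕ< 0<n)
    corner : Col11 c x₀
    corner = fromℕ< 0<m , fromℕ< 0<n , toℕ-fromℕ< 0<m , toℕ-fromℕ< 0<n , refl
    corner-unique : ∀ {x} → Col11 c x → x ≡ x₀
    corner-unique (i₀ , j₀ , i₀≡0 , j₀≡0 , cᵢ₀ⱼ₀≡x) = trans (sym cᵢ₀ⱼ₀≡x) (cong₂ c
      (toℕ-injective (trans i₀≡0 (sym (toℕ-fromℕ< 0<m))))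
      (toℕ-injective (trans j₀≡0 (sym (toℕ-fromℕ< 0<n)))))
    before : ∀ i → toℕ i < toℕ p → mainColor i ≡ x₀
    before i i<p = corner-unique
      (small i (inject≤ i m≤n) (sym (toℕ-inject≤ i m≤n)) (subst (suc (toℕ i) <_) 1+p≡s (s≤s i<p)))
    changes : mainColor p ≢ x₀
    changes dp≡x₀ = p∉corner (subst (Col11 c) (trans (sym dp≡x₀) (cong (c p) injectp≡j)) corner)
      where
      injectp≡j : inject≤ p m≤n ≡ j
      injectp≡j = toℕ-injective (trans (toℕ-inject≤ p m≤n) p≡j)

  main-palette-bound : ∀ {s} → IsS2 c s → ∃ λ e → count (colorIn? m) ≤ 2 + e × s * 2 ^ e ≤ m
  main-palette-bound isS2 with p , refl , x₀ , before , changes ← isS2⇒firstChange isS2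
    with e , palette , growth ← palette-bound mainColor mainColor-rainbowFree p x₀ before changes =
    e , ≤-trans (count-mono (colorIn? m) (seen? mainColor m) main-colors) palette , growth

exponent-bound : ∀ {N D C P e} → 2 ≤ N → N + 1 ≤ D + C → D ≤ 2 + e → C + C ≤ P + N →
  N ∸ 2 ∸ P ≤ e + e
exponent-bound {suc (suc w)} {D} {C} {P} {e} (s≤s (s≤s _)) colors palette pairs =
  m≤n+o⇒m∸n≤o w P (+-cancelˡ-≤ (6 + w) w (P + (e + e)) (begin
    6 + w + w                      ≡⟨ lhs w ⟩
    (2 + w + 1) + (2 + w + 1)      ≤⟨ +-mono-≤ colors colors ⟩
    (D + C) + (D + C)              ≤⟨ +-mono-≤ (+-monoˡ-≤ C palette) (+-monoˡ-≤ C palette) ⟩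
    (2 + e + C) + (2 + e + C)      ≡⟨ middle e C ⟩
    (4 + (e + e)) + (C + C)        ≤⟨ +-monoʳ-≤ (4 + (e + e)) pairs ⟩
    (4 + (e + e)) + (P + (2 + w))  ≡⟨ rhs e P w ⟩
    6 + w + (P + (e + e))          ∎))
  where
  open ≤-Reasoning
  lhs : ∀ w → 6 + w + w ≡ (2 + w + 1) + (2 + w + 1)
  lhs = solve-∀
  middle : ∀ e C → (2 + e + C) + (2 + e + C) ≡ (4 + (e + e)) + (C + C)
  middle = solve-∀
  rhs : ∀ e P w → (4 + (e + e)) + (P + (2 + w)) ≡ 6 + w + (P + (e + e))
  rhs = solve-∀

square-bound : ∀ s e {m D} → D ≤ e + e → s * 2 ^ e ≤ m → s * s * 2 ^ D ≤ m * m
square-bound s e {m} {D} D≤2e bound = begin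
  s * s * 2 ^ D              ≤⟨ *-monoʳ-≤ (s * s) (^-monoʳ-≤ 2 D≤2e) ⟩
  s * s * 2 ^ (e + e)        ≡⟨ cong (s * s *_) (^-distribˡ-+-* 2 e e) ⟩
  s * s * (2 ^ e * 2 ^ e)    ≡⟨ regroup s (2 ^ e) ⟩
  (s * 2 ^ e) * (s * 2 ^ e)  ≤⟨ *-mono-≤ bound bound ⟩
  m * m                      ∎
  where
  open ≤-Reasoning
  regroup : ∀ s y → s * s * (y * y) ≡ (s * y) * (s * y)
  regroup = solve-∀

lemma5p1 : (m n : ℕ) → 3 ≤ m → m ≤ n →
    (c : Coloring m n (m + n + 1)) → Exact c → NoRainbow c →
    (s₂ : ℕ) → IsS2 c s₂ → ManyConsecPairs c s₂
lemma5p1 m n 3≤m m≤n c exact noRainbow s₂ isS2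
  with e , few-main , growth ← Diagonals.main-palette-bound m≤n c noRainbow isS2 =
  pairList ,
  adjacentPairs-unique contributingOffDiag? L ,
  adjacentPairs-adjacent contributingOffDiag? L ,
  square-bound s₂ e (exponent-bound {P = length pairList} 2≤m+n (color-count exact) few-main pairs) growth
  where
  open Diagonals m≤n c noRainbow
  L : ℕ
  L = m + n ∸ 1
  pairList : List ℕ
  pairList = adjacentPairs contributingOffDiag? L
  2≤m+n : 2 ≤ m + n
  2≤m+n = ≤-trans (≤-trans (s≤s (s≤s z≤n)) 3≤m) (m≤m+n m n)
  C : ℕ
  C = count {suc L} (λ k → contributingOffDiag? (toℕ k))
  pairs : C + C ≤ length pairList + (m + n)
  pairs = ≤-trans (adjacentPairs-count′ contributingOffDiag? L (λ ()))
    (≤-reflexive (cong (length pairList +_) (m+[n∸m]≡n (≤-trans (s≤s z≤n) 2≤m+n))))
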